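{- Let $\Gamma$ be a finite cc0-language. Every degenerate value $y\in\mathrm{dom}(\Gamma)$ is produced by a nondegenerate value $x\in\mathrm{dom}(\Gamma)$.
   Context: $D$ is finite with distinguished $0$; $\Gamma$ is a finite set of relations on $D$, $\mathrm{dom}(\Gamma)$ the set of values in its tuples. $\Gamma$ is a cc0-language if all its relations contain the all-zero tuple and every such relation obtained from a relation of $\Gamma$ by substituting constants for some coordinates belongs to $\Gamma$. A multivalued morphism is $\phi:\mathrm{dom}(\Gamma)\to 2^{\mathrm{dom}(\Gamma)}$ with $\phi(0)=\{0\}$ and $\phi(a_1)\times\dots\times\phi(a_r)\subseteq R$ for all $(a_1,..,a_r)\in R\in\Gamma$. $x$ produces $y$ if some multivalued morphism has $\phi(x)=\{0,y\}$ and $\phi(z)=\{0\}$ for all $z\ne x$. A value $y$ is regular if no multivalued morphism has $0,y\in\phi(x)$ for some $x$; semiregular if such $\phi$ exists but no value produces $y$; self-producing if $y$ produces $y$ and $y$ produces every value that produces $y$; degenerate otherwise. -}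

module Defs where

open import Data.Nat using (ℕ; zero; suc)
open import Data.Fin using (Fin)
open import Data.Vec using (Vec; []; _∷_; replicate; lookup)
open import Data.Vec.Membership.Propositional using () renaming (_∈_ to _∈ᵥ_)
open import Data.Maybe using (Maybe; just; nothing)
open import Data.Bool using (Bool; true)
open import Data.Product using (Σ; ∃; _×_; _,_)
open import Data.Sum using (_⊎_)
open import Relation.Nullary using (¬_)
open import Relation.Binary.PropositionalEquality using (_≡_; _≢_; subst; sym)
open import Function.Bundles using (_⇔_)

Dom : ℕ → Set
Dom n = Fin (suc n)

𝟘 : ∀ {n} → Dom n
𝟘 = Fin.zero

record Language (n : ℕ) : Set where
  field
    k   : ℕ
    ar  : Fin k → ℕ
    rel : (i : Fin k) → Vec (Dom n) (ar i) → Bool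
open Language public

-- Partial substitution of constants: `just a` = coordinate fixed to constant a,
-- `nothing` = coordinate left free.
holes : ∀ {A : Set} {r : ℕ} → Vec (Maybe A) r → ℕ
holes [] = zero
holes (nothing ∷ c) = suc (holes c)
holes (just _ ∷ c) = holes c

fill : ∀ {A : Set} {r : ℕ} (c : Vec (Maybe A) r) → Vec A (holes c) → Vec A r
fill [] _ = []
fill (nothing ∷ c) (a ∷ t) = a ∷ fill c t
fill (just b ∷ c) t = b ∷ fill c t

_∈Γ_ : ∀ {n m} → (Γ : Language n) → (Vec (Dom n) m → Bool) → Set
_∈Γ_ {n} {m} Γ S = ∃ λ (j : Fin (k Γ)) → Σ (ar Γ j ≡ m) λ p →
  ∀ (t : Vec (Dom n) m) → rel Γ j (subst (Vec (Dom n)) (sym p) t) ≡ S t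

IsCC0 : ∀ {n} → Language n → Set
IsCC0 {n} Γ =
  (∀ i → rel Γ i (replicate (ar Γ i) 𝟘) ≡ true) ×
  (∀ i (c : Vec (Maybe (Dom n)) (ar Γ i)) →
     rel Γ i (fill c (replicate (holes c) 𝟘)) ≡ true →
     _∈Γ_ {m = holes c} Γ (λ t → rel Γ i (fill c t)))

InDom : ∀ {n} → Language n → Dom n → Set
InDom {n} Γ y = ∃ λ i → ∃ λ (t : Vec (Dom n) (ar Γ i)) → (rel Γ i t ≡ true) × (y ∈ᵥ t)

-- A multivalued morphism φ : dom(Γ) → 2^dom(Γ), represented by φ x w ≡ true
-- meaning w ∈ φ(x); values of φ outside dom(Γ) are irrelevant.
record MVM {n} (Γ : Language n) : Set where
  field
    φ        : Dom n → Dom n → Bool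
    into-dom : ∀ x w → InDom Γ x → φ x w ≡ true → InDom Γ w
    zero-map : ∀ w → φ 𝟘 w ≡ true ⇔ w ≡ 𝟘
    preserves : ∀ i (t s : Vec (Dom n) (ar Γ i)) → rel Γ i t ≡ true →
                (∀ j → φ (lookup t j) (lookup s j) ≡ true) → rel Γ i s ≡ true
open MVM public

Produces : ∀ {n} → Language n → Dom n → Dom n → Set
Produces {n} Γ x y = Σ (MVM Γ) λ Φ →
  (∀ w → φ Φ x w ≡ true ⇔ (w ≡ 𝟘 ⊎ w ≡ y)) ×
  (∀ z → InDom Γ z → z ≢ x → ∀ w → φ Φ z w ≡ true ⇔ w ≡ 𝟘)

Regular : ∀ {n} → Language n → Dom n → Set
Regular Γ y = ¬ (Σ (MVM Γ) λ Φ → ∃ λ x → InDom Γ x × (φ Φ x 𝟘 ≡ true) × (φ Φ x y ≡ true))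

Semiregular : ∀ {n} → Language n → Dom n → Set
Semiregular Γ y = ¬ Regular Γ y × ¬ (∃ λ x → InDom Γ x × Produces Γ x y)

SelfProducing : ∀ {n} → Language n → Dom n → Set
SelfProducing Γ y = Produces Γ y y × (∀ x → InDom Γ x → Produces Γ x y → Produces Γ y x)

Degenerate : ∀ {n} → Language n → Dom n → Set
Degenerate Γ y = ¬ Regular Γ y × ¬ Semiregular Γ y × ¬ SelfProducing Γ y

module Submission where

-- 1. Production is decidable.  "x produces y" is witnessed by one specific
--    multivalued morphism, a ↦ {0} ∪ {y | a = x}, so it is equivalent to the
--    finite condition `Producible x y` (Γ is closed under the corresponding
--    substitutions), which is decided by exhaustive search over tuples.
-- 2. Production is transitive: a substitution step x ⇝ z factors through a
--    step x ⇝ y followed by a step y ⇝ z, coordinatewise.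
-- 3. A decidable transitive relation on a finite set has maximal elements
--    above every element, because its strict part is well-founded.
-- 4. A value that is neither regular nor semiregular has a producer; so a
--    maximal producer x of a degenerate y, if degenerate itself, would
--    produce itself and everything producing it, i.e. be self-producing.

open import Defs
open import Data.Nat using (ℕ; zero; suc)
open import Data.Bool using (true)
import Data.Bool.Properties as Bool
open import Data.Fin using (Fin) renaming (_≟_ to _≟ᶠ_)
open import Data.Fin.Properties using (any?; all?; ¬∀⟶∃¬)
open import Data.Fin.Induction using (spo-wellFounded)
open import Data.Vec using (Vec; []; _∷_; lookup; tabulate)
open import Data.Vec.Properties using (lookup∘tabulate)
open import Data.Vec.Membership.Propositional.Properties using (∈-lookup)
import Data.Vec.Membership.DecPropositional as DecMembership
open import Data.Product using (∃; _×_; _,_; proj₁; proj₂)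
open import Data.Sum using (_⊎_; inj₁; inj₂)
open import Data.Empty using (⊥-elim)
open import Function.Bundles using (_⇔_; mk⇔; Equivalence)
open import Induction.WellFounded using (Acc; acc)
open import Level using (Level)
open import Relation.Binary.Core using (Rel)
open import Relation.Binary.Definitions using (Decidable; Transitive)
open import Relation.Binary.Structures using (IsStrictPartialOrder)
open import Relation.Nullary using (¬_; Dec; yes; no; does)
open import Relation.Nullary.Decidable
  using (map′; _×-dec_; _→-dec_; dec-true; decidable-stable)
open import Relation.Binary.PropositionalEquality
  using (_≡_; refl; sym; subst; isEquivalence; resp₂)

from-does : ∀ {P : Set} (p? : Dec P) → does p? ≡ true → P
from-does (yes p) _ = p
from-does (no _) ()

∃-tuple? : ∀ {m r} {P : Vec (Fin m) r → Set} →
           (∀ t → Dec (P t)) → Dec (∃ P)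
∃-tuple? {r = zero} P? = map′ ([] ,_) (λ { ([] , p) → p }) (P? [])
∃-tuple? {r = suc r} P? =
  map′ (λ { (a , t , p) → a ∷ t , p }) (λ { (a ∷ t , p) → a , t , p })
       (any? λ a → ∃-tuple? (λ t → P? (a ∷ t)))

∀-tuple? : ∀ {m r} {P : Vec (Fin m) r → Set} →
           (∀ t → Dec (P t)) → Dec (∀ t → P t)
∀-tuple? {r = zero} P? = map′ (λ { p [] → p }) (λ f → f []) (P? [])
∀-tuple? {r = suc r} P? =
  map′ (λ { f (a ∷ t) → f a t }) (λ f a t → f (a ∷ t))
       (all? λ a → ∀-tuple? (λ t → P? (a ∷ t)))

module Maximality {m : ℕ} {ℓ : Level} (_▷_ : Rel (Fin m) ℓ)
                  (_▷?_ : Decidable _▷_) (▷-trans : Transitive _▷_) where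

  Maximal : Fin m → Set ℓ
  Maximal x = ∀ w → w ▷ x → x ▷ w

  _▶_ : Rel (Fin m) ℓ
  w ▶ x = w ▷ x × ¬ (x ▷ w)

  ▶-isStrictPartialOrder : IsStrictPartialOrder _≡_ _▶_
  ▶-isStrictPartialOrder = record
    { isEquivalence = isEquivalence
    ; irrefl        = λ { refl (x▷x , ¬x▷x) → ¬x▷x x▷x }
    ; trans         = λ (u▷v , ¬v▷u) (v▷w , ¬w▷v) →
                        ▷-trans u▷v v▷w , λ w▷u → ¬w▷v (▷-trans w▷u u▷v)
    ; <-resp-≈      = resp₂ _▶_
    }

  strictly-above : ∀ x → ¬ Maximal x → ∃ λ w → w ▶ x
  strictly-above x ¬max
    with w , ¬[w▷x⇒x▷w] ← ¬∀⟶∃¬ m _ (λ w → (w ▷? x) →-dec (x ▷? w)) ¬max =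
    w , decidable-stable (w ▷? x) (λ ¬w▷x → ¬[w▷x⇒x▷w] (λ w▷x → ⊥-elim (¬w▷x w▷x)))
      , λ x▷w → ¬[w▷x⇒x▷w] (λ _ → x▷w)

  maximal-above : ∀ {a y} → a ▷ y → ∃ λ x → x ▷ y × Maximal x
  maximal-above {a} {y} = climb a (spo-wellFounded ▶-isStrictPartialOrder a)
    where
    climb : ∀ x → Acc _▶_ x → x ▷ y → ∃ λ x → x ▷ y × Maximal x
    climb x (acc higher) x▷y with all? (λ w → (w ▷? x) →-dec (x ▷? w))
    ... | yes max = x , x▷y , max
    ... | no ¬max with w , w▷x , ¬x▷w ← strictly-above x ¬max =
      climb w (higher (w▷x , ¬x▷w)) (▷-trans w▷x x▷y)

module Production {n : ℕ} (Γ : Language n) where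

  open DecMembership (_≟ᶠ_ {suc n}) using (_∈?_)

  InDom? : ∀ y → Dec (InDom Γ y)
  InDom? y = any? λ i → ∃-tuple? λ t → (rel Γ i t Bool.≟ true) ×-dec (y ∈? t)

  -- b ∈ φ(a) for the multivalued morphism a ↦ {0} ∪ {y | a = x}.
  Step : Dom n → Dom n → Dom n → Dom n → Set
  Step x y a b = b ≡ 𝟘 ⊎ (a ≡ x × b ≡ y)

  Step? : ∀ x y a b → Dec (Step x y a b)
  Step? x y a b with b ≟ᶠ 𝟘 | a ≟ᶠ x | b ≟ᶠ y
  ... | yes b≡0 | _        | _        = yes (inj₁ b≡0)
  ... | no _    | yes a≡x  | yes b≡y  = yes (inj₂ (a≡x , b≡y))
  ... | no b≢0  | no a≢x   | _        = no λ { (inj₁ b≡0) → b≢0 b≡0 ; (inj₂ (a≡x , _)) → a≢x a≡x }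
  ... | no b≢0  | yes _    | no b≢y   = no λ { (inj₁ b≡0) → b≢0 b≡0 ; (inj₂ (_ , b≡y)) → b≢y b≡y }

  Preserves : Dom n → Dom n → Set
  Preserves x y = ∀ i (t s : Vec (Dom n) (ar Γ i)) → rel Γ i t ≡ true →
    (∀ j → Step x y (lookup t j) (lookup s j)) → rel Γ i s ≡ true

  Preserves? : ∀ x y → Dec (Preserves x y)
  Preserves? x y = all? λ i → ∀-tuple? λ t → ∀-tuple? λ s →
    (rel Γ i t Bool.≟ true) →-dec
      ((all? λ j → Step? x y (lookup t j) (lookup s j)) →-dec (rel Γ i s Bool.≟ true))

  -- The finite condition under which a ↦ {0} ∪ {y | a = x} is a multivalued
  -- morphism witnessing that x produces y.
  record Producible (x y : Dom n) : Set where
    field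
      zero∈dom   : InDom Γ 𝟘
      target∈dom : InDom Γ y
      zero-fixed : x ≡ 𝟘 → y ≡ 𝟘
      closed     : Preserves x y
  open Producible

  Producible? : ∀ x y → Dec (Producible x y)
  Producible? x y =
    map′ (λ (0∈ , y∈ , fix , cl) → record { zero∈dom = 0∈ ; target∈dom = y∈ ; zero-fixed = fix ; closed = cl })
         (λ p → zero∈dom p , target∈dom p , zero-fixed p , closed p)
         (InDom? 𝟘 ×-dec InDom? y ×-dec ((x ≟ᶠ 𝟘) →-dec (y ≟ᶠ 𝟘)) ×-dec Preserves? x y)

  producible⇒produces : ∀ {x y} → Producible x y → Produces Γ x y
  producible⇒produces {x} {y} p = Φ , on-x , elsewhere
    where
    Φ : MVM Γ
    φ Φ a b = does (Step? x y a b)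
    into-dom Φ a b _ a↦b with from-does (Step? x y a b) a↦b
    ... | inj₁ refl       = zero∈dom p
    ... | inj₂ (_ , refl) = target∈dom p
    zero-map Φ b = mk⇔ to (λ b≡0 → dec-true (Step? x y 𝟘 b) (inj₁ b≡0))
      where
      to : does (Step? x y 𝟘 b) ≡ true → b ≡ 𝟘
      to 0↦b with from-does (Step? x y 𝟘 b) 0↦b
      ... | inj₁ b≡0           = b≡0
      ... | inj₂ (0≡x , refl) = zero-fixed p (sym 0≡x)
    preserves Φ i t s t∈ steps = closed p i t s t∈ (λ j → from-does (Step? x y _ _) (steps j))

    on-x : ∀ b → φ Φ x b ≡ true ⇔ (b ≡ 𝟘 ⊎ b ≡ y)
    on-x b = mk⇔ to from
      where
      to : does (Step? x y x b) ≡ true → b ≡ 𝟘 ⊎ b ≡ y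
      to x↦b with from-does (Step? x y x b) x↦b
      ... | inj₁ b≡0       = inj₁ b≡0
      ... | inj₂ (_ , b≡y) = inj₂ b≡y
      from : b ≡ 𝟘 ⊎ b ≡ y → does (Step? x y x b) ≡ true
      from (inj₁ b≡0) = dec-true (Step? x y x b) (inj₁ b≡0)
      from (inj₂ b≡y) = dec-true (Step? x y x b) (inj₂ (refl , b≡y))

    elsewhere : ∀ a → InDom Γ a → ¬ a ≡ x → ∀ b → φ Φ a b ≡ true ⇔ b ≡ 𝟘
    elsewhere a _ a≢x b = mk⇔ to (λ b≡0 → dec-true (Step? x y a b) (inj₁ b≡0))
      where
      to : does (Step? x y a b) ≡ true → b ≡ 𝟘
      to a↦b with from-does (Step? x y a b) a↦b
      ... | inj₁ b≡0       = b≡0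
      ... | inj₂ (a≡x , _) = ⊥-elim (a≢x a≡x)

  produces⇒producible : ∀ {x y} → InDom Γ x → Produces Γ x y → Producible x y
  produces⇒producible {x} {y} x∈ (Φ , on-x , elsewhere) = record
    { zero∈dom   = into-dom Φ x 𝟘 x∈ x↦0
    ; target∈dom = into-dom Φ x y x∈ x↦y
    ; zero-fixed = λ { refl → Equivalence.to (zero-map Φ y) x↦y }
    ; closed     = λ i t s t∈ steps →
        preserves Φ i t s t∈ (λ j → step⊆φ (i , t , t∈ , ∈-lookup j t) (steps j))
    }
    where
    x↦y : φ Φ x y ≡ true
    x↦y = Equivalence.from (on-x y) (inj₂ refl)
    x↦0 : φ Φ x 𝟘 ≡ true
    x↦0 = Equivalence.from (on-x 𝟘) (inj₁ refl)

    step⊆φ : ∀ {a b} → InDom Γ a → Step x y a b → φ Φ a b ≡ true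
    step⊆φ _ (inj₂ (refl , refl)) = x↦y
    step⊆φ {a} a∈ (inj₁ refl) with a ≟ᶠ x
    ... | yes refl = x↦0
    ... | no a≢x   = Equivalence.from (elsewhere a a∈ a≢x 𝟘) refl

  factor : ∀ {x y z a b} → Step x z a b → ∃ λ c → Step x y a c × Step y z c b
  factor (inj₁ b≡0)         = 𝟘 , inj₁ refl , inj₁ b≡0
  factor (inj₂ (a≡x , b≡z)) = _ , inj₂ (a≡x , refl) , inj₂ (refl , b≡z)

  preserves-trans : ∀ {x y z} → Preserves x y → Preserves y z → Preserves x z
  preserves-trans {x} {y} {z} cl-xy cl-yz i t s t∈ steps =
    cl-yz i u s (cl-xy i t u t∈ first) second
    where
    middle : Fin (ar Γ i) → Dom n
    middle j = proj₁ (factor {y = y} (steps j))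
    u : Vec (Dom n) (ar Γ i)
    u = tabulate middle
    first : ∀ j → Step x y (lookup t j) (lookup u j)
    first j = subst (Step x y (lookup t j)) (sym (lookup∘tabulate middle j))
                    (proj₁ (proj₂ (factor (steps j))))
    second : ∀ j → Step y z (lookup u j) (lookup s j)
    second j = subst (λ c → Step y z c (lookup s j)) (sym (lookup∘tabulate middle j))
                     (proj₂ (proj₂ (factor (steps j))))

  producible-trans : ∀ {x y z} → Producible x y → Producible y z → Producible x z
  producible-trans p q = record
    { zero∈dom   = zero∈dom p
    ; target∈dom = target∈dom q
    ; zero-fixed = λ x≡0 → zero-fixed q (zero-fixed p x≡0)
    ; closed     = preserves-trans (closed p) (closed q)
    }

  _▷_ : Rel (Dom n) _
  w ▷ x = InDom Γ w × Producible w x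

  _▷?_ : Decidable _▷_
  w ▷? x = InDom? w ×-dec Producible? w x

  ▷-trans : Transitive _▷_
  ▷-trans (u∈ , u→v) (_ , v→w) = u∈ , producible-trans u→v v→w

  open Maximality _▷_ _▷?_ ▷-trans public using (Maximal; maximal-above)

  has-producer : ∀ {y} → ¬ Regular Γ y → ¬ Semiregular Γ y → ∃ λ x → x ▷ y
  has-producer {y} ¬reg ¬semi with any? (λ x → x ▷? y)
  ... | yes found = found
  ... | no none   = ⊥-elim (¬semi (¬reg , λ (x , x∈ , x→y) →
                      none (x , x∈ , produces⇒producible x∈ x→y)))

  maximal⇒self-producing : ∀ {x} → Maximal x → ∃ (λ w → w ▷ x) → SelfProducing Γ x
  maximal⇒self-producing max (w , w▷x) =
    producible⇒produces (proj₂ (▷-trans (max w w▷x) w▷x)) ,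
    λ v v∈ v→x → producible⇒produces (proj₂ (max v (v∈ , produces⇒producible v∈ v→x)))

  maximal⇒nondegenerate : ∀ {x} → Maximal x → ¬ Degenerate Γ x
  maximal⇒nondegenerate max (¬reg , ¬semi , ¬self) =
    ¬self (maximal⇒self-producing max (has-producer ¬reg ¬semi))

open Production

proposition3p10 : ∀ {n : ℕ} (Γ : Language n) → IsCC0 Γ →
    ∀ (y : Dom n) → InDom Γ y → Degenerate Γ y →
    ∃ λ (x : Dom n) → InDom Γ x × ¬ Degenerate Γ x × Produces Γ x y
proposition3p10 Γ _ y _ (¬reg , ¬semi , _)
  with a , a▷y ← has-producer Γ ¬reg ¬semi
  with x , (x∈ , x→y) , max ← maximal-above Γ a▷y =
  x , x∈ , maximal⇒nondegenerate Γ max , producible⇒produces Γ x→y
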